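{- Let $\Pi$ be a finite set of proposition symbols, let $\Lambda$ be a $\Pi$-program of $\mathrm{MPMSC}$ and let $d\in\mathbb Z_+$. One can construct a $\Pi$-program $\Lambda'$ of $\mathrm{MPMSC}$, strongly equivalent to $\Lambda$, such that: (1) every proposition symbol in $\Pi$ appears in $\Lambda'$; (2) every proposition symbol occurring in $\Lambda$ is weakly $d$-omnipresent in $\Lambda'$; (3) every head predicate of $\Lambda$ is $d$-omnipresent in $\Lambda'$; (4) the size of $\Lambda'$ is $\mathcal{O}(d|\Lambda|+|\Pi|)$.
   Context: Kripke models with identifiers: over $\Pi$ (proposition symbols, with a linearly ordered subset $\Pi_1$ of identifier symbols), $M=(W,R,V)$ where the bit string of truth values of $\Pi_1$ at $w$, $\mathrm{ID}(w)$, is injective in $w$. If the successors of $w$ have identifiers $s_1<\dots<s_d$ lexicographically, the one with $s_i$ is the $i$th neighbour of $w$. MPMSC: schemata built by $\varphi::=\top\mid p\mid X\mid\neg\varphi\mid(\varphi\wedge\varphi)\mid\Diamond_i\varphi$ ($p\in\Pi$, $X$ a schema variable, $i\in\mathbb Z_+$), $\Diamond_i\varphi$ holding at $w$ iff $w$ has an $i$th neighbour and $\varphi$ holds there. A $\Pi$-program has distinct heads $Y_1,\dots,Y_k$ (fixed order), diamond- and variable-free terminal clauses $Y_i(0):=\varphi_i$, and for each $i$ an iteration clause, either standard $Y_i:=\psi$ or conditional $Y_i:=_{\varphi_1,\dots,\varphi_n}\psi_1;\dots;\psi_n;\chi$, with conditions of modal depth $0$ and $\psi,\psi_j,\chi$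 of modal depth at most $1$; plus attention/print predicates. Semantics: $Y_i^0=\varphi_i$; standard: $Y_i^{n+1}=\psi^{n+1}$; conditional: $Y_i^{n+1}=\bigvee_{j\le n}\big(\bigwedge_{j'<j}\neg\varphi_{j'}^{n+1}\wedge\varphi_j^{n+1}\wedge\psi_j^{n+1}\big)\vee\big(\bigwedge_{j\le n}\neg\varphi_j^{n+1}\wedge\chi^{n+1}\big)$ ($\theta^{n+1}$: replace each $Y_l$ by $Y_l^n$). The round-$n$ configuration at $w$ is the $k$-bit string with $i$th bit $1$ iff $(M,w)\models Y_i^n$; its restriction to attention/print positions is the appointed string. Two programs are strongly equivalent if on every Kripke model with identifiers interpreting their symbols, at every node and every round they produce the same appointed string. Size = number of occurrences of proposition symbols, head predicates, $\top,\neg,\wedge,\Diamond_i$. Omnipresence: a proposition symbol or head predicate $x$ is $d$-omnipresent in a program if (a) $x$ appears in some body of an iteration clause not in the scope of any diamond, and (b) for each $i\in[d]$, $x$ appears in some body of an iteration clause within the scope of $\Diamond_i$. A proposition symbol $p$ is weakly $d$-omnipresent if either $p$ appears in no iteration clause of the program, or $p$ is $d$-omnipresent in it. -}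

module Defs where

open import Data.Nat using (ℕ; zero; suc; _+_; _*_; _≤_; _≡ᵇ_)
open import Data.Bool using (Bool; true; false; _∧_; _∨_; not; if_then_else_)
open import Data.Fin using (Fin)
open import Data.List using (List; []; _∷_; _++_; map; allFin; filterᵇ)
open import Data.Bool.ListAction using (any)
open import Data.Nat.ListAction using (sum)
open import Data.List.NonEmpty using (List⁺) renaming (toList to toList⁺)
open import Data.Vec using (Vec; []; _∷_; tabulate)
open import Data.Product using (Σ; _×_; _,_; proj₁; proj₂)
open import Data.Sum using (_⊎_; inj₁; inj₂)
open import Relation.Binary.PropositionalEquality using (_≡_)
open import Function.Definitions using (Injective)
import Data.Empty
open import Data.List.Relation.Unary.All using (All)
open import Data.Nat using (_⊔_; pred)
open import Relation.Nullary.Decidable.Core using (does)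
open import Data.Fin using (_≟_)

-- Proposition symbols: Π = Fin nP.
-- Identifier symbols Π₁ ⊆ Π with a linear order: an injective map
-- ids : Fin m → Fin nP; the order of Π₁ is the order of the indices.

-- Kripke models (with identifiers).  The domain is Fin N (any model with
-- identifiers is finite, since ID is injective into bit strings of
-- length m).  R and V are Boolean-valued.

record Model (nP : ℕ) : Set where
  field
    N : ℕ
    R : Fin N → Fin N → Bool
    V : Fin N → Fin nP → Bool

module _ {nP m : ℕ} (ids : Fin m → Fin nP) (M : Model nP) where
  open Model M

  ID : Fin N → Vec Bool m
  ID w = tabulate (λ j → V w (ids j))

lexLt : {m : ℕ} → Vec Bool m → Vec Bool m → Bool
lexLt [] [] = false
lexLt (false ∷ xs) (false ∷ ys) = lexLt xs ys
lexLt (true ∷ xs) (true ∷ ys) = lexLt xs ys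
lexLt (false ∷ xs) (true ∷ ys) = true
lexLt (true ∷ xs) (false ∷ ys) = false

IsIdModel : {nP m : ℕ} → (Fin m → Fin nP) → Model nP → Set
IsIdModel ids M = Injective _≡_ _≡_ (ID ids M)

module _ {nP m : ℕ} (ids : Fin m → Fin nP) (M : Model nP) where
  open Model M

  rankBelow : Fin N → Fin N → ℕ
  rankBelow w v = sum (map (λ u → if R w u ∧ lexLt (ID ids M u) (ID ids M v)
                                   then 1 else 0) (allFin N))

  -- v is the (j+1)-th neighbour of w
  isNeighbour : ℕ → Fin N → Fin N → Bool
  isNeighbour j w v = R w v ∧ (rankBelow w v ≡ᵇ j)

-- MPMSC schemata over Π = Fin nP with schema variables (head
-- predicates) Fin k.  `dia j φ` denotes ◇_{j+1} φ (indices are in ℤ₊).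

data Schema (nP k : ℕ) : Set where
  top  : Schema nP k
  prop : Fin nP → Schema nP k
  var  : Fin k → Schema nP k
  neg  : Schema nP k → Schema nP k
  conj : Schema nP k → Schema nP k → Schema nP k
  dia  : ℕ → Schema nP k → Schema nP k

md : {nP k : ℕ} → Schema nP k → ℕ
md top = 0
md (prop p) = 0
md (var X) = 0
md (neg φ) = md φ
md (conj φ ψ) = md φ ⊔ md ψ
md (dia j φ) = suc (md φ)

varFree : {nP k : ℕ} → Schema nP k → Bool
varFree top = true
varFree (prop p) = true
varFree (var X) = false
varFree (neg φ) = varFree φ
varFree (conj φ ψ) = varFree φ ∧ varFree ψ
varFree (dia j φ) = varFree φ

-- iteration clauses: standard  Y := ψ,  or conditional
-- Y :=_{φ₁,…,φₙ} ψ₁;…;ψₙ;χ  given as a nonempty list of pairs (φⱼ , ψⱼ) and χ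
data Clause (nP k : ℕ) : Set where
  standard    : Schema nP k → Clause nP k
  conditional : List⁺ (Schema nP k × Schema nP k) → Schema nP k → Clause nP k

record Program (nP : ℕ) : Set where
  field
    k         : ℕ
    terminal  : Fin k → Schema nP k
    iteration : Fin k → Clause nP k
    attention : Fin k → Bool
    print     : Fin k → Bool

WFClause : {nP k : ℕ} → Clause nP k → Set
WFClause (standard ψ) = md ψ ≤ 1
WFClause (conditional cs χ) =
  All
    (λ c → (md (proj₁ c) ≡ 0) × (md (proj₂ c) ≤ 1)) (toList⁺ cs)
  × (md χ ≤ 1)

WF : {nP : ℕ} → Program nP → Set
WF Λ = ((l : Fin k) → (md (terminal l) ≡ 0) × (varFree (terminal l) ≡ true))
     × ((l : Fin k) → WFClause (iteration l))
  where open Program Λ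

module _ {nP m : ℕ} (ids : Fin m → Fin nP) (M : Model nP) where
  open Model M

  eval : {k : ℕ} → (Fin k → Fin N → Bool) → Schema nP k → Fin N → Bool
  eval env top w = true
  eval env (prop p) w = V w p
  eval env (var X) w = env X w
  eval env (neg φ) w = not (eval env φ w)
  eval env (conj φ ψ) w = eval env φ w ∧ eval env ψ w
  eval env (dia j φ) w =
    any (λ v → isNeighbour ids M j w v ∧ eval env φ v) (allFin N)

  evalCond : {k : ℕ} → (Fin k → Fin N → Bool) →
             List (Schema nP k × Schema nP k) → Schema nP k → Fin N → Bool
  evalCond env [] χ w = eval env χ w
  evalCond env ((φ , ψ) ∷ cs) χ w =
    if eval env φ w then eval env ψ w else evalCond env cs χ w

  evalClause : {k : ℕ} → (Fin k → Fin N → Bool) → Clause nP k → Fin N → Bool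
  evalClause env (standard ψ) w = eval env ψ w
  evalClause env (conditional cs χ) w = evalCond env (toList⁺ cs) χ w

  -- round-n values of the heads:  config Λ n l w  ⇔  (M,w) ⊨ Y_l^n
  config : (Λ : Program nP) → ℕ → Fin (Program.k Λ) → Fin N → Bool
  config Λ zero l w = eval (λ _ _ → false) (Program.terminal Λ l) w
  config Λ (suc n) l w = evalClause (config Λ n) (Program.iteration Λ l) w

  appointed : (Λ : Program nP) → ℕ → Fin N → List Bool × List Bool
  appointed Λ n w =
    map (λ l → config Λ n l w) (filterᵇ (Program.attention Λ) (allFin (Program.k Λ))) ,
    map (λ l → config Λ n l w) (filterᵇ (Program.print Λ) (allFin (Program.k Λ)))

StronglyEquivalent : {nP m : ℕ} → (Fin m → Fin nP) → Program nP → Program nP → Set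
StronglyEquivalent {nP} ids Λ Λ' =
  (M : Model nP) → IsIdModel ids M → (w : Fin (Model.N M)) → (n : ℕ) →
  appointed ids M Λ n w ≡ appointed ids M Λ' n w

Sym : ℕ → ℕ → Set
Sym nP k = Fin nP ⊎ Fin k

isSym : {nP k : ℕ} → Sym nP k → Schema nP k → Bool
isSym (inj₁ p) (prop q) = does (p ≟ q)
isSym (inj₂ X) (var Y) = does (X ≟ Y)
isSym x _ = false

occurs : {nP k : ℕ} → Sym nP k → Schema nP k → Bool
occurs x (neg φ) = occurs x φ
occurs x (conj φ ψ) = occurs x φ ∨ occurs x ψ
occurs x (dia j φ) = occurs x φ
occurs x φ = isSym x φ

occursFree : {nP k : ℕ} → Sym nP k → Schema nP k → Bool
occursFree x (neg φ) = occursFree x φ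
occursFree x (conj φ ψ) = occursFree x φ ∨ occursFree x ψ
occursFree x (dia j φ) = false
occursFree x φ = isSym x φ

occursUnder : {nP k : ℕ} → ℕ → Sym nP k → Schema nP k → Bool
occursUnder i x (neg φ) = occursUnder i x φ
occursUnder i x (conj φ ψ) = occursUnder i x φ ∨ occursUnder i x ψ
occursUnder i x (dia j φ) = if j ≡ᵇ i then occurs x φ else occursUnder i x φ
occursUnder i x φ = false

clauseSchemata : {nP k : ℕ} → Clause nP k → List (Schema nP k)
clauseSchemata (standard ψ) = ψ ∷ []
clauseSchemata (conditional cs χ) =
  map proj₁ (toList⁺ cs) ++ map proj₂ (toList⁺ cs) ++ χ ∷ []

module _ {nP : ℕ} (Λ : Program nP) where
  open Program Λ

  AppearsIn : Sym nP k → Set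
  AppearsIn x = any (λ l → occurs x (terminal l)
                          ∨ any (occurs x) (clauseSchemata (iteration l)))
                    (allFin k) ≡ true

  AppearsInIteration : Sym nP k → Set
  AppearsInIteration x =
    any (λ l → any (occurs x) (clauseSchemata (iteration l))) (allFin k) ≡ true

  Omnipresent : ℕ → Sym nP k → Set
  Omnipresent d x =
    (any (λ l → any (occursFree x) (clauseSchemata (iteration l))) (allFin k) ≡ true)
    × ((i : ℕ) → 1 ≤ i → i ≤ d →
       any (λ l → any (occursUnder (pred i) x)
                      (clauseSchemata (iteration l))) (allFin k) ≡ true)

  WeaklyOmnipresent : ℕ → Fin nP → Set
  WeaklyOmnipresent d p =
    (AppearsInIteration (inj₁ p) → Data.Empty.⊥) ⊎ Omnipresent d (inj₁ p)

-- Size: occurrences of proposition symbols, head predicates, ⊤, ¬, ∧, ◇ᵢ.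
-- Heads are counted in the bodies and on the left-hand sides of the
-- 2k clauses.

sizeS : {nP k : ℕ} → Schema nP k → ℕ
sizeS top = 1
sizeS (prop p) = 1
sizeS (var X) = 1
sizeS (neg φ) = suc (sizeS φ)
sizeS (conj φ ψ) = suc (sizeS φ + sizeS ψ)
sizeS (dia j φ) = suc (sizeS φ)

sizeC : {nP k : ℕ} → Clause nP k → ℕ
sizeC c = sum (map sizeS (clauseSchemata c))

sizeP : {nP : ℕ} → Program nP → ℕ
sizeP Λ = sum (map (λ l → 2 + sizeS (terminal l) + sizeC (iteration l)) (allFin k))
  where open Program Λ

{-# OPTIONS --safe #-}
module Submission where

-- Add to Λ one fresh head Z that is neither an attention nor a print predicate; the old heads are
-- only renamed, so they compute exactly as before and the appointed strings do not change. The
-- terminal clause of Z is the conjunction of all proposition symbols, so every symbol appears. Its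
-- iteration clause is the conjunction over the heads Y of θ ∧ ◇₁θ ∧ … ∧ ◇_d θ, where θ is Y
-- conjoined with the diamond-free skeleton of all clauses of Y: every symbol of Y's clauses then
-- occurs outside diamonds and under each ◇ᵢ with i ≤ d, at the price of d + 1 copies of each clause.

open import Defs
open import Data.Bool using (Bool; true; false; T; not; _∧_; _∨_)
open import Data.Bool.ListAction using (any; or)
open import Data.Bool.Properties using (T-≡; T-∨)
open import Data.Fin using (Fin; zero; suc; _≟_)
open import Data.Fin.Properties using (suc-injective)
open import Data.List using (List; []; _∷_; [_]; _++_; map; allFin; filterᵇ; tabulate; length)
import Data.List.NonEmpty as List⁺
open import Data.List.Properties using (map-∘; map-cong; map-++; map-tabulate; tabulate-cong; length-tabulate)
import Data.List.Relation.Unary.All as All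
import Data.List.Relation.Unary.All.Properties as All
open import Data.List.Relation.Unary.Any using (Any)
import Data.List.Relation.Unary.Any as Any
open import Data.List.Relation.Unary.Any.Properties using (any⁺; any⁻)
import Data.List.Relation.Unary.Any.Properties as Any
open import Data.List.Membership.Propositional.Properties using (∈-allFin)
open import Data.Nat using (ℕ; zero; suc; _≤_; _<_; _*_; _+_; _⊔_; _≡ᵇ_; z≤n; s≤s)
open import Data.Nat.ListAction using (sum)
open import Data.Nat.Properties
  using (≤-refl; ≤-trans; ≤-reflexive; ⊔-lub; n≤0⇒n≡0; m≤n+m; m≤m+n; m≤n*m; m<n+m; +-suc; *-suc;
         +-identityʳ; *-zeroʳ; *-distribˡ-+; +-mono-≤; +-monoˡ-≤; +-monoʳ-≤; *-monoʳ-≤;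
         m≤n⇒m≤1+n; m<1+n⇒m<n∨m≡n; ≡⇒≡ᵇ; module ≤-Reasoning)
open import Data.Nat.Tactic.RingSolver using (solve-∀)
open import Data.Product using (Σ; _×_; _,_; proj₁; proj₂)
import Data.Product as Product
open import Data.Sum using (inj₁; inj₂)
import Data.Sum as Sum
import Data.Vec.Functional as Vector
open import Function using (_∘_; id)
open import Function.Bundles using (Equivalence)
open import Function.Definitions using (Injective)
open import Relation.Binary.PropositionalEquality
  using (_≡_; refl; sym; trans; cong; cong₂; subst; module ≡-Reasoning)
open import Relation.Nullary.Decidable using (does; dec-true)

open Equivalence using (to; from)

private
  variable
    A B : Set
    nP K L : ℕ

filterᵇ-map : (p : B → Bool) (f : A → B) (xs : List A) →
              filterᵇ p (map f xs) ≡ map f (filterᵇ (p ∘ f) xs)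
filterᵇ-map p f [] = refl
filterᵇ-map p f (x ∷ xs) with p (f x)
... | true  = cong (f x ∷_) (filterᵇ-map p f xs)
... | false = filterᵇ-map p f xs

map-filterᵇ-allFin-suc : ∀ {n} (h : Fin (suc n) → A) (p : Fin n → Bool) →
  map h (filterᵇ (false Vector.∷ p) (allFin (suc n))) ≡ map (h ∘ suc) (filterᵇ p (allFin n))
map-filterᵇ-allFin-suc {n = n} h p = begin
  map h (filterᵇ (false Vector.∷ p) (tabulate suc))
    ≡⟨ cong (map h ∘ filterᵇ _) (map-tabulate id suc) ⟨
  map h (filterᵇ (false Vector.∷ p) (map suc (allFin n)))
    ≡⟨ cong (map h) (filterᵇ-map _ suc (allFin n)) ⟩
  map h (map suc (filterᵇ p (allFin n)))
    ≡⟨ map-∘ _ ⟨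
  map (h ∘ suc) (filterᵇ p (allFin n))
    ∎
  where open ≡-Reasoning

sum-map-mono : {f g : A → ℕ} → (∀ x → f x ≤ g x) → ∀ xs → sum (map f xs) ≤ sum (map g xs)
sum-map-mono f≤g [] = z≤n
sum-map-mono f≤g (x ∷ xs) = +-mono-≤ (f≤g x) (sum-map-mono f≤g xs)

sum-map-* : ∀ c (f : A → ℕ) xs → sum (map (λ x → c * f x) xs) ≡ c * sum (map f xs)
sum-map-* c f [] = sym (*-zeroʳ c)
sum-map-* c f (x ∷ xs) = trans (cong (c * f x +_) (sum-map-* c f xs)) (sym (*-distribˡ-+ c (f x) _))

rename : (Fin K → Fin L) → Schema nP K → Schema nP L
rename ρ top        = top
rename ρ (prop p)   = prop p
rename ρ (var X)    = var (ρ X)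
rename ρ (neg φ)    = neg (rename ρ φ)
rename ρ (conj φ ψ) = conj (rename ρ φ) (rename ρ ψ)
rename ρ (dia j φ)  = dia j (rename ρ φ)

renameClause : (Fin K → Fin L) → Clause nP K → Clause nP L
renameClause ρ (standard ψ)       = standard (rename ρ ψ)
renameClause ρ (conditional cs χ) =
  conditional (List⁺.map (Product.map (rename ρ) (rename ρ)) cs) (rename ρ χ)

module _ (ρ : Fin K → Fin L) where

  md-rename : (φ : Schema nP K) → md (rename ρ φ) ≡ md φ
  md-rename top        = refl
  md-rename (prop p)   = refl
  md-rename (var X)    = refl
  md-rename (neg φ)    = md-rename φ
  md-rename (conj φ ψ) = cong₂ _⊔_ (md-rename φ) (md-rename ψ)
  md-rename (dia j φ)  = cong suc (md-rename φ)

  varFree-rename : (φ : Schema nP K) → varFree (rename ρ φ) ≡ varFree φ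
  varFree-rename top        = refl
  varFree-rename (prop p)   = refl
  varFree-rename (var X)    = refl
  varFree-rename (neg φ)    = varFree-rename φ
  varFree-rename (conj φ ψ) = cong₂ _∧_ (varFree-rename φ) (varFree-rename ψ)
  varFree-rename (dia j φ)  = varFree-rename φ

  sizeS-rename : (φ : Schema nP K) → sizeS (rename ρ φ) ≡ sizeS φ
  sizeS-rename top        = refl
  sizeS-rename (prop p)   = refl
  sizeS-rename (var X)    = refl
  sizeS-rename (neg φ)    = cong suc (sizeS-rename φ)
  sizeS-rename (conj φ ψ) = cong suc (cong₂ _+_ (sizeS-rename φ) (sizeS-rename ψ))
  sizeS-rename (dia j φ)  = cong suc (sizeS-rename φ)

  occurs-rename : (p : Fin nP) (φ : Schema nP K) → occurs (inj₁ p) (rename ρ φ) ≡ occurs (inj₁ p) φ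
  occurs-rename p top        = refl
  occurs-rename p (prop q)   = refl
  occurs-rename p (var X)    = refl
  occurs-rename p (neg φ)    = occurs-rename p φ
  occurs-rename p (conj φ ψ) = cong₂ _∨_ (occurs-rename p φ) (occurs-rename p ψ)
  occurs-rename p (dia j φ)  = occurs-rename p φ

  WFClause-renameClause : (c : Clause nP K) → WFClause c → WFClause (renameClause ρ c)
  WFClause-renameClause (standard ψ) md≤1 = subst (_≤ 1) (sym (md-rename ψ)) md≤1
  WFClause-renameClause (conditional cs χ) (wf-cs , md≤1) =
    All.map⁺ (All.map (λ {c} → wf-pair c) wf-cs) , subst (_≤ 1) (sym (md-rename χ)) md≤1
    where
    wf-pair : (c : Schema nP K × Schema nP K) → (md (proj₁ c) ≡ 0) × (md (proj₂ c) ≤ 1) →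
              (md (rename ρ (proj₁ c)) ≡ 0) × (md (rename ρ (proj₂ c)) ≤ 1)
    wf-pair (φ , ψ) (md≡0 , md≤1) = trans (md-rename φ) md≡0 , subst (_≤ 1) (sym (md-rename ψ)) md≤1

  clauseSchemata-renameClause : (c : Clause nP K) →
    clauseSchemata (renameClause ρ c) ≡ map (rename ρ) (clauseSchemata c)
  clauseSchemata-renameClause (standard ψ) = refl
  clauseSchemata-renameClause {nP = nP} (conditional cs χ) = begin
    map proj₁ (map ρ² pairs) ++ map proj₂ (map ρ² pairs) ++ [ rename ρ χ ]
      ≡⟨ cong₂ (λ as bs → as ++ bs ++ [ rename ρ χ ]) fuse₁ fuse₂ ⟩
    map (rename ρ) (map proj₁ pairs) ++ map (rename ρ) (map proj₂ pairs) ++ map (rename ρ) [ χ ]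
      ≡⟨ cong (map (rename ρ) (map proj₁ pairs) ++_) (map-++ (rename ρ) (map proj₂ pairs) [ χ ]) ⟨
    map (rename ρ) (map proj₁ pairs) ++ map (rename ρ) (map proj₂ pairs ++ [ χ ])
      ≡⟨ map-++ (rename ρ) (map proj₁ pairs) _ ⟨
    map (rename ρ) (map proj₁ pairs ++ map proj₂ pairs ++ [ χ ])
      ∎
    where
    open ≡-Reasoning
    pairs : List (Schema nP K × Schema nP K)
    pairs = List⁺.toList cs
    ρ² : Schema nP K × Schema nP K → Schema nP L × Schema nP L
    ρ² = Product.map (rename ρ) (rename ρ)
    fuse₁ : map proj₁ (map ρ² pairs) ≡ map (rename ρ) (map proj₁ pairs)
    fuse₁ = trans (sym (map-∘ pairs)) (map-∘ pairs)
    fuse₂ : map proj₂ (map ρ² pairs) ≡ map (rename ρ) (map proj₂ pairs)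
    fuse₂ = trans (sym (map-∘ pairs)) (map-∘ pairs)

  sizeC-renameClause : (c : Clause nP K) → sizeC (renameClause ρ c) ≡ sizeC c
  sizeC-renameClause c = begin
    sum (map sizeS (clauseSchemata (renameClause ρ c)))
      ≡⟨ cong (sum ∘ map sizeS) (clauseSchemata-renameClause c) ⟩
    sum (map sizeS (map (rename ρ) (clauseSchemata c)))
      ≡⟨ cong sum (map-∘ (clauseSchemata c)) ⟨
    sum (map (sizeS ∘ rename ρ) (clauseSchemata c))
      ≡⟨ cong sum (map-cong sizeS-rename (clauseSchemata c)) ⟩
    sizeC c
      ∎
    where open ≡-Reasoning

⋀ : List (Schema nP K) → Schema nP K
⋀ []       = top
⋀ (φ ∷ φs) = conj φ (⋀ φs)

T-≟-refl : ∀ {n} (i : Fin n) → T (does (i ≟ i))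
T-≟-refl i = from T-≡ (dec-true (i ≟ i) refl)

isSym-top : (x : Sym nP K) → isSym x top ≡ false
isSym-top (inj₁ p) = refl
isSym-top (inj₂ X) = refl

⋀-any : (Q : Schema nP K → Bool) → Q top ≡ false → (∀ φ ψ → Q (conj φ ψ) ≡ Q φ ∨ Q ψ) →
        ∀ φs → Q (⋀ φs) ≡ any Q φs
⋀-any Q Q⊤ Q∧ []       = Q⊤
⋀-any Q Q⊤ Q∧ (φ ∷ φs) = trans (Q∧ φ (⋀ φs)) (cong (Q φ ∨_) (⋀-any Q Q⊤ Q∧ φs))

occurs-⋀ : (x : Sym nP K) (φs : List (Schema nP K)) → occurs x (⋀ φs) ≡ any (occurs x) φs
occurs-⋀ x = ⋀-any (occurs x) (isSym-top x) (λ _ _ → refl)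

occursFree-⋀ : (x : Sym nP K) (φs : List (Schema nP K)) → occursFree x (⋀ φs) ≡ any (occursFree x) φs
occursFree-⋀ x = ⋀-any (occursFree x) (isSym-top x) (λ _ _ → refl)

occursUnder-⋀ : ∀ i (x : Sym nP K) (φs : List (Schema nP K)) →
                occursUnder i x (⋀ φs) ≡ any (occursUnder i x) φs
occursUnder-⋀ i x = ⋀-any (occursUnder i x) refl (λ _ _ → refl)

md-⋀-map : ∀ {c} (f : A → Schema nP K) → (∀ a → md (f a) ≤ c) → ∀ as → md (⋀ (map f as)) ≤ c
md-⋀-map f md≤c []       = z≤n
md-⋀-map f md≤c (a ∷ as) = ⊔-lub (md≤c a) (md-⋀-map f md≤c as)

varFree-⋀-props : (ps : List (Fin nP)) → varFree {k = K} (⋀ (map prop ps)) ≡ true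
varFree-⋀-props []       = refl
varFree-⋀-props (p ∷ ps) = varFree-⋀-props ps

sizeS-⋀-props : (ps : List (Fin nP)) → sizeS {k = K} (⋀ (map prop ps)) ≡ suc (2 * length ps)
sizeS-⋀-props []       = refl
sizeS-⋀-props (p ∷ ps) = trans (cong (2 +_) (sizeS-⋀-props ps)) (cong suc (sym (*-suc 2 (length ps))))

sizeS-positive : (φ : Schema nP K) → 1 ≤ sizeS φ
sizeS-positive top        = s≤s z≤n
sizeS-positive (prop p)   = s≤s z≤n
sizeS-positive (var X)    = s≤s z≤n
sizeS-positive (neg φ)    = s≤s z≤n
sizeS-positive (conj φ ψ) = s≤s z≤n
sizeS-positive (dia j φ)  = s≤s z≤n

sizeS-⋀ : (φs : List (Schema nP K)) → sizeS (⋀ φs) ≡ suc (sum (map (suc ∘ sizeS) φs))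
sizeS-⋀ []       = refl
sizeS-⋀ (φ ∷ φs) = cong suc (trans (cong (sizeS φ +_) (sizeS-⋀ φs)) (+-suc (sizeS φ) _))

sizeS-⋀-≤ : (φs : List (Schema nP K)) → sizeS (⋀ φs) ≤ suc (2 * sum (map sizeS φs))
sizeS-⋀-≤ φs = begin
  sizeS (⋀ φs)                            ≡⟨ sizeS-⋀ φs ⟩
  suc (sum (map (suc ∘ sizeS) φs))        ≤⟨ s≤s (sum-map-mono suc-sizeS≤ φs) ⟩
  suc (sum (map (λ φ → 2 * sizeS φ) φs))  ≡⟨ cong suc (sum-map-* 2 sizeS φs) ⟩
  suc (2 * sum (map sizeS φs))            ∎
  where
  open ≤-Reasoning
  suc-sizeS≤ : (φ : Schema nP K) → suc (sizeS φ) ≤ 2 * sizeS φ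
  suc-sizeS≤ φ = ≤-trans (m<n+m (sizeS φ) (sizeS-positive φ))
                         (≤-reflexive (cong (sizeS φ +_) (sym (+-identityʳ (sizeS φ)))))

flatten : Schema nP K → Schema nP K
flatten top        = top
flatten (prop p)   = prop p
flatten (var X)    = var X
flatten (neg φ)    = neg (flatten φ)
flatten (conj φ ψ) = conj (flatten φ) (flatten ψ)
flatten (dia j φ)  = flatten φ

md-flatten : (φ : Schema nP K) → md (flatten φ) ≡ 0
md-flatten top        = refl
md-flatten (prop p)   = refl
md-flatten (var X)    = refl
md-flatten (neg φ)    = md-flatten φ
md-flatten (conj φ ψ) = cong₂ _⊔_ (md-flatten φ) (md-flatten ψ)
md-flatten (dia j φ)  = md-flatten φ

sizeS-flatten : (φ : Schema nP K) → sizeS (flatten φ) ≤ sizeS φ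
sizeS-flatten top        = ≤-refl
sizeS-flatten (prop p)   = ≤-refl
sizeS-flatten (var X)    = ≤-refl
sizeS-flatten (neg φ)    = s≤s (sizeS-flatten φ)
sizeS-flatten (conj φ ψ) = s≤s (+-mono-≤ (sizeS-flatten φ) (sizeS-flatten ψ))
sizeS-flatten (dia j φ)  = m≤n⇒m≤1+n (sizeS-flatten φ)

occursFree-flatten : (x : Sym nP K) (φ : Schema nP K) → occursFree x (flatten φ) ≡ occurs x φ
occursFree-flatten x top        = refl
occursFree-flatten x (prop p)   = refl
occursFree-flatten x (var X)    = refl
occursFree-flatten x (neg φ)    = occursFree-flatten x φ
occursFree-flatten x (conj φ ψ) = cong₂ _∨_ (occursFree-flatten x φ) (occursFree-flatten x ψ)
occursFree-flatten x (dia j φ)  = occursFree-flatten x φ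

occursFree⇒occurs : (x : Sym nP K) (φ : Schema nP K) → T (occursFree x φ) → T (occurs x φ)
occursFree⇒occurs x top        = id
occursFree⇒occurs x (prop p)   = id
occursFree⇒occurs x (var X)    = id
occursFree⇒occurs x (neg φ)    = occursFree⇒occurs x φ
occursFree⇒occurs x (conj φ ψ) =
  from T-∨ ∘ Sum.map (occursFree⇒occurs x φ) (occursFree⇒occurs x ψ) ∘ to T-∨
occursFree⇒occurs x (dia j φ)  = λ ()

occursUnder-dia : ∀ i (x : Sym nP K) ψ → T (occurs x ψ) → T (occursUnder i x (dia i ψ))
occursUnder-dia i x ψ occ with i ≡ᵇ i | ≡⇒≡ᵇ i i refl
... | true | _ = occ

-- With the zero-based diamonds of Defs, spread i ψ is ψ ∧ ◇₁ψ ∧ … ∧ ◇ᵢψ.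
spread : ℕ → Schema nP K → Schema nP K
spread zero    ψ = ψ
spread (suc i) ψ = conj (spread i ψ) (dia i ψ)

md-spread : (ψ : Schema nP K) → md ψ ≡ 0 → ∀ i → md (spread i ψ) ≤ 1
md-spread ψ md≡0 zero    = ≤-trans (≤-reflexive md≡0) z≤n
md-spread ψ md≡0 (suc i) = ⊔-lub (md-spread ψ md≡0 i) (s≤s (≤-reflexive md≡0))

sizeS-spread : (ψ : Schema nP K) → ∀ i → sizeS (spread i ψ) ≡ sizeS ψ + i * (2 + sizeS ψ)
sizeS-spread ψ zero    = sym (+-identityʳ (sizeS ψ))
sizeS-spread ψ (suc i) =
  trans (cong (λ s → suc (s + suc (sizeS ψ))) (sizeS-spread ψ i)) (shuffle (sizeS ψ) i)
  where
  shuffle : ∀ s i → suc (s + i * (2 + s) + suc s) ≡ s + suc i * (2 + s)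
  shuffle = solve-∀

spread-size-bound : ∀ d r s → s ≤ suc (2 * suc r) → s + suc d * (2 + s) ≤ 5 * (suc d * (2 + r))
spread-size-bound d r s s≤t = begin
  s + suc d * (2 + s)                               ≤⟨ +-mono-≤ s≤t (*-monoʳ-≤ (suc d) (+-monoʳ-≤ 2 s≤t)) ⟩
  t + suc d * (2 + t)                               ≤⟨ m≤m+n _ _ ⟩
  t + suc d * (2 + t) + (2 + r + 3 * d * r + 5 * d) ≡⟨ expand d r ⟩
  5 * (suc d * (2 + r))                             ∎
  where
  open ≤-Reasoning
  t = suc (2 * suc r)
  expand : ∀ d r → suc (2 * suc r) + suc d * (2 + suc (2 * suc r)) + (2 + r + 3 * d * r + 5 * d)
                   ≡ 5 * (suc d * (2 + r))
  expand = solve-∀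

OmnipresentIn : ℕ → Sym nP K → Schema nP K → Set
OmnipresentIn d x φ = T (occursFree x φ) × (∀ i → i < d → T (occursUnder i x φ))

spread-omnipresentIn : (x : Sym nP K) (ψ : Schema nP K) → T (occursFree x ψ) →
                       ∀ d → OmnipresentIn d x (spread d ψ)
spread-omnipresentIn x ψ free zero    = free , λ _ ()
spread-omnipresentIn x ψ free (suc d) = from T-∨ (inj₁ (proj₁ below)) , under
  where
  below : OmnipresentIn d x (spread d ψ)
  below = spread-omnipresentIn x ψ free d
  under : ∀ i → i < suc d → T (occursUnder i x (spread (suc d) ψ))
  under i i<1+d with m<1+n⇒m<n∨m≡n i<1+d
  ... | inj₁ i<d  = from T-∨ (inj₁ (proj₂ below i i<d))
  ... | inj₂ refl = from T-∨ (inj₂ (occursUnder-dia i x ψ (occursFree⇒occurs x ψ free)))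

⋀-omnipresentIn : ∀ {d} (x : Sym nP K) (φs : List (Schema nP K)) →
                  Any (OmnipresentIn d x) φs → OmnipresentIn d x (⋀ φs)
⋀-omnipresentIn x φs omni =
  subst T (sym (occursFree-⋀ x φs)) (any⁺ _ (Any.map proj₁ omni)) ,
  λ i i<d → subst T (sym (occursUnder-⋀ i x φs)) (any⁺ _ (Any.map (λ o → proj₂ o i i<d) omni))

module _ {m : ℕ} (ids : Fin m → Fin nP) (M : Model nP) (ρ : Fin K → Fin L)
         {env : Fin L → Fin (Model.N M) → Bool} {env′ : Fin K → Fin (Model.N M) → Bool}
         (env∘ρ≗env′ : ∀ X w → env (ρ X) w ≡ env′ X w) where
  open Model M

  eval-rename : (φ : Schema nP K) (w : Fin N) → eval ids M env (rename ρ φ) w ≡ eval ids M env′ φ w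
  eval-rename top        w = refl
  eval-rename (prop p)   w = refl
  eval-rename (var X)    w = env∘ρ≗env′ X w
  eval-rename (neg φ)    w = cong not (eval-rename φ w)
  eval-rename (conj φ ψ) w = cong₂ _∧_ (eval-rename φ w) (eval-rename ψ w)
  eval-rename (dia j φ)  w =
    cong or (map-cong (λ v → cong (isNeighbour ids M j w v ∧_) (eval-rename φ v)) (allFin N))

  evalCond-rename : (cs : List (Schema nP K × Schema nP K)) (χ : Schema nP K) (w : Fin N) →
    evalCond ids M env (map (Product.map (rename ρ) (rename ρ)) cs) (rename ρ χ) w
      ≡ evalCond ids M env′ cs χ w
  evalCond-rename []             χ w = eval-rename χ w
  evalCond-rename ((φ , ψ) ∷ cs) χ w
    rewrite eval-rename φ w | eval-rename ψ w | evalCond-rename cs χ w = refl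

  evalClause-rename : (c : Clause nP K) (w : Fin N) →
                      evalClause ids M env (renameClause ρ c) w ≡ evalClause ids M env′ c w
  evalClause-rename (standard ψ)       w = eval-rename ψ w
  evalClause-rename (conditional cs χ) w = evalCond-rename (List⁺.toList cs) χ w

headSize : (Λ : Program nP) → Fin (Program.k Λ) → ℕ
headSize Λ l = 2 + sizeS (terminal l) + sizeC (iteration l)
  where open Program Λ

module _ (Λ : Program nP) where
  open Program Λ

  withHiddenHead : Schema nP (suc k) → Clause nP (suc k) → Program nP
  withHiddenHead θ γ = record
    { k         = suc k
    ; terminal  = θ Vector.∷ (rename suc ∘ terminal)
    ; iteration = γ Vector.∷ (renameClause suc ∘ iteration)
    ; attention = false Vector.∷ attention
    ; print     = false Vector.∷ print
    }

  module _ (θ : Schema nP (suc k)) (γ : Clause nP (suc k)) where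
    open Program (withHiddenHead θ γ) using () renaming (terminal to terminal′; iteration to iteration′)

    WF-withHiddenHead : WF Λ → md θ ≡ 0 → varFree θ ≡ true → WFClause γ → WF (withHiddenHead θ γ)
    WF-withHiddenHead (wf-terminal , wf-iteration) md≡0 closed wf-γ = wf-terminal′ , wf-iteration′
      where
      wf-terminal′ : ∀ l → (md (terminal′ l) ≡ 0) × (varFree (terminal′ l) ≡ true)
      wf-terminal′ zero    = md≡0 , closed
      wf-terminal′ (suc l) = trans (md-rename suc (terminal l)) (proj₁ (wf-terminal l)) ,
                             trans (varFree-rename suc (terminal l)) (proj₂ (wf-terminal l))
      wf-iteration′ : ∀ l → WFClause (iteration′ l)
      wf-iteration′ zero    = wf-γ
      wf-iteration′ (suc l) = WFClause-renameClause suc (iteration l) (wf-iteration l)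

    config-withHiddenHead : ∀ {m} (ids : Fin m → Fin nP) (M : Model nP) n l w →
      config ids M (withHiddenHead θ γ) n (suc l) w ≡ config ids M Λ n l w
    config-withHiddenHead ids M zero    l w = eval-rename ids M suc (λ _ _ → refl) (terminal l) w
    config-withHiddenHead ids M (suc n) l w =
      evalClause-rename ids M suc (config-withHiddenHead ids M n) (iteration l) w

    withHiddenHead-stronglyEquivalent : ∀ {m} (ids : Fin m → Fin nP) →
                                        StronglyEquivalent ids Λ (withHiddenHead θ γ)
    withHiddenHead-stronglyEquivalent ids M _ w n = sym (cong₂ _,_ (visible attention) (visible print))
      where
      visible : (shown : Fin k → Bool) →
        map (λ l → config ids M (withHiddenHead θ γ) n l w)
            (filterᵇ (false Vector.∷ shown) (allFin (suc k)))
          ≡ map (λ l → config ids M Λ n l w) (filterᵇ shown (allFin k))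
      visible shown = trans (map-filterᵇ-allFin-suc _ shown)
                            (map-cong (λ l → config-withHiddenHead ids M n l w) _)

    sizeP-withHiddenHead : sizeP (withHiddenHead θ γ) ≡ (2 + sizeS θ + sizeC γ) + sizeP Λ
    sizeP-withHiddenHead = cong ((2 + sizeS θ + sizeC γ) +_) (begin
      sum (map (headSize (withHiddenHead θ γ)) (tabulate suc))
        ≡⟨ cong sum (map-tabulate suc (headSize (withHiddenHead θ γ))) ⟩
      sum (tabulate (headSize (withHiddenHead θ γ) ∘ suc))
        ≡⟨ cong sum (tabulate-cong renamed-headSize) ⟩
      sum (tabulate (headSize Λ))
        ≡⟨ cong sum (map-tabulate id (headSize Λ)) ⟨
      sizeP Λ
        ∎)
      where
      open ≡-Reasoning
      renamed-headSize : ∀ l → headSize (withHiddenHead θ γ) (suc l) ≡ headSize Λ l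
      renamed-headSize l = cong₂ (λ s c → 2 + s + c) (sizeS-rename suc (terminal l))
                                                     (sizeC-renameClause suc (iteration l))

    appearsIn-withHiddenHead : (x : Sym nP (suc k)) → T (occurs x θ) → AppearsIn (withHiddenHead θ γ) x
    appearsIn-withHiddenHead x occ = to T-≡ (from T-∨ (inj₁ (from T-∨ (inj₁ occ))))

  omnipresent-withHiddenHead : (θ φ : Schema nP (suc k)) → ∀ {d} (x : Sym nP (suc k)) →
    OmnipresentIn d x φ → Omnipresent (withHiddenHead θ (standard φ)) d x
  omnipresent-withHiddenHead θ φ x (free , under) =
    atHiddenHead free , λ { (suc i) _ i<d → atHiddenHead (under i i<d) }
    where
    atHiddenHead : ∀ {b r} → T b → (b ∨ false) ∨ r ≡ true
    atHiddenHead t = to T-≡ (from T-∨ (inj₁ (from T-∨ (inj₁ t))))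

  clauseConjunction : Fin k → Schema nP k
  clauseConjunction l = ⋀ (var l ∷ terminal l ∷ clauseSchemata (iteration l))

  skeleton : Fin k → Schema nP (suc k)
  skeleton l = flatten (rename suc (clauseConjunction l))

  head-occursFree-skeleton : (l : Fin k) → T (occursFree (inj₂ (suc l)) (skeleton l))
  head-occursFree-skeleton l = from T-∨ (inj₁ (T-≟-refl (suc l)))

  prop-occursFree-skeleton : (p : Fin nP) (l : Fin k) → occursFree (inj₁ p) (skeleton l)
    ≡ (occurs (inj₁ p) (terminal l) ∨ any (occurs (inj₁ p)) (clauseSchemata (iteration l)))
  prop-occursFree-skeleton p l = begin
    occursFree (inj₁ p) (skeleton l)
      ≡⟨ occursFree-flatten (inj₁ p) (rename suc (clauseConjunction l)) ⟩
    occurs (inj₁ p) (rename suc (clauseConjunction l))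
      ≡⟨ occurs-rename suc p (clauseConjunction l) ⟩
    occurs (inj₁ p) (clauseConjunction l)
      ≡⟨ occurs-⋀ (inj₁ p) (var l ∷ terminal l ∷ clauseSchemata (iteration l)) ⟩
    any (occurs (inj₁ p)) (var l ∷ terminal l ∷ clauseSchemata (iteration l))
      ∎
    where open ≡-Reasoning

  sizeS-skeleton : ∀ l → sizeS (skeleton l) ≤ suc (2 * suc (sizeS (terminal l) + sizeC (iteration l)))
  sizeS-skeleton l = begin
    sizeS (skeleton l)
      ≤⟨ sizeS-flatten (rename suc (clauseConjunction l)) ⟩
    sizeS (rename suc (clauseConjunction l))
      ≡⟨ sizeS-rename suc (clauseConjunction l) ⟩
    sizeS (clauseConjunction l)
      ≤⟨ sizeS-⋀-≤ (var l ∷ terminal l ∷ clauseSchemata (iteration l)) ⟩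
    suc (2 * suc (sizeS (terminal l) + sizeC (iteration l)))
      ∎
    where open ≤-Reasoning

  allProps : Schema nP (suc k)
  allProps = ⋀ (map prop (allFin nP))

  sizeS-allProps : sizeS allProps ≡ suc (2 * nP)
  sizeS-allProps =
    trans (sizeS-⋀-props (allFin nP)) (cong (λ n → suc (2 * n)) (length-tabulate {n = nP} id))

  module _ (d : ℕ) where

    omnipresenceClause : Schema nP (suc k)
    omnipresenceClause = ⋀ (map (spread d ∘ skeleton) (allFin k))

    padded : Program nP
    padded = withHiddenHead allProps (standard omnipresenceClause)

    WF-padded : WF Λ → WF padded
    WF-padded wf = WF-withHiddenHead allProps (standard omnipresenceClause) wf
      (n≤0⇒n≡0 (md-⋀-map prop (λ _ → z≤n) (allFin nP)))
      (varFree-⋀-props (allFin nP))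
      (md-⋀-map (spread d ∘ skeleton) md-spread-skeleton (allFin k))
      where
      md-spread-skeleton : ∀ l → md (spread d (skeleton l)) ≤ 1
      md-spread-skeleton l = md-spread (skeleton l) (md-flatten (rename suc (clauseConjunction l))) d

    appearsIn-padded : (p : Fin nP) → AppearsIn padded (inj₁ p)
    appearsIn-padded p = appearsIn-withHiddenHead allProps (standard omnipresenceClause) (inj₁ p)
      (subst T (sym (occurs-⋀ (inj₁ p) (map prop (allFin nP))))
         (any⁺ _ (Any.map⁺ (Any.map (λ { refl → T-≟-refl p }) (∈-allFin p)))))

    skeleton-omnipresent : (x : Sym nP (suc k)) (l : Fin k) → T (occursFree x (skeleton l)) →
                           Omnipresent padded d x
    skeleton-omnipresent x l free = omnipresent-withHiddenHead allProps omnipresenceClause x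
      (⋀-omnipresentIn x (map (spread d ∘ skeleton) (allFin k))
         (Any.map⁺ (Any.map (λ { refl → spread-omnipresentIn x (skeleton l) free d }) (∈-allFin l))))

    props-weaklyOmnipresent : (p : Fin nP) → AppearsIn Λ (inj₁ p) → WeaklyOmnipresent padded d p
    props-weaklyOmnipresent p appears with Any.satisfied (any⁻ _ (allFin k) (from T-≡ appears))
    ... | l , occ =
      inj₂ (skeleton-omnipresent (inj₁ p) l (subst T (sym (prop-occursFree-skeleton p l)) occ))

  module _ (d : ℕ) where

    sizeS-omnipresenceClause : sizeS (omnipresenceClause (suc d)) ≤ suc (2 * (5 * (suc d * sizeP Λ)))
    sizeS-omnipresenceClause = begin
      sizeS (⋀ (map spread-skeleton (allFin k)))
        ≤⟨ sizeS-⋀-≤ (map spread-skeleton (allFin k)) ⟩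
      suc (2 * sum (map sizeS (map spread-skeleton (allFin k))))
        ≡⟨ cong (λ s → suc (2 * sum s)) (map-∘ (allFin k)) ⟨
      suc (2 * sum (map (sizeS ∘ spread-skeleton) (allFin k)))
        ≤⟨ s≤s (*-monoʳ-≤ 2 (sum-map-mono per-head (allFin k))) ⟩
      suc (2 * sum (map (λ l → 5 * (suc d * headSize Λ l)) (allFin k)))
        ≡⟨ cong (λ s → suc (2 * s)) (sum-map-* 5 _ (allFin k)) ⟩
      suc (2 * (5 * sum (map (λ l → suc d * headSize Λ l) (allFin k))))
        ≡⟨ cong (λ s → suc (2 * (5 * s))) (sum-map-* (suc d) (headSize Λ) (allFin k)) ⟩
      suc (2 * (5 * (suc d * sizeP Λ)))
        ∎
      where
      open ≤-Reasoning
      spread-skeleton : Fin k → Schema nP (suc k)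
      spread-skeleton = spread (suc d) ∘ skeleton
      per-head : ∀ l → sizeS (spread-skeleton l) ≤ 5 * (suc d * headSize Λ l)
      per-head l = begin
        sizeS (spread-skeleton l)                 ≡⟨ sizeS-spread (skeleton l) (suc d) ⟩
        sizeS (skeleton l) + suc d * (2 + sizeS (skeleton l))
          ≤⟨ spread-size-bound d _ (sizeS (skeleton l)) (sizeS-skeleton l) ⟩
        5 * (suc d * headSize Λ l)                ∎

    sizeP-padded : 1 ≤ suc d * sizeP Λ + nP → sizeP (padded (suc d)) ≤ 15 * (suc d * sizeP Λ + nP)
    sizeP-padded nonempty = begin
      sizeP (padded (suc d))
        ≡⟨ sizeP-withHiddenHead allProps (standard (omnipresenceClause (suc d))) ⟩
      2 + sizeS allProps + (sizeS (omnipresenceClause (suc d)) + 0) + sizeP Λ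
        ≤⟨ +-monoˡ-≤ (sizeP Λ) (+-mono-≤ (≤-reflexive (cong (2 +_) sizeS-allProps))
                                         (+-monoˡ-≤ 0 sizeS-omnipresenceClause)) ⟩
      2 + suc (2 * nP) + (suc (2 * (5 * X)) + 0) + sizeP Λ
        ≤⟨ +-monoʳ-≤ _ (m≤n*m (sizeP Λ) (suc d)) ⟩
      2 + suc (2 * nP) + (suc (2 * (5 * X)) + 0) + X
        ≡⟨ regroup nP X ⟩
      4 + (2 * nP + 11 * X)
        ≤⟨ +-monoˡ-≤ _ (*-monoʳ-≤ 4 nonempty) ⟩
      4 * (X + nP) + (2 * nP + 11 * X)
        ≤⟨ m≤m+n _ (9 * nP) ⟩
      4 * (X + nP) + (2 * nP + 11 * X) + 9 * nP
        ≡⟨ collect nP X ⟩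
      15 * (X + nP)
        ∎
      where
      open ≤-Reasoning
      X : ℕ
      X = suc d * sizeP Λ
      regroup : ∀ n X → 2 + suc (2 * n) + (suc (2 * (5 * X)) + 0) + X ≡ 4 + (2 * n + 11 * X)
      regroup = solve-∀
      collect : ∀ n X → 4 * (X + n) + (2 * n + 11 * X) + 9 * n ≡ 15 * (X + n)
      collect = solve-∀

IsOmnipresentVersion : ∀ {m} → (Fin m → Fin nP) → ℕ → ℕ → Program nP → Program nP → Set
IsOmnipresentVersion {nP = nP} ids d C Λ Λ′ =
  WF Λ′
  × StronglyEquivalent ids Λ Λ′
  × ((p : Fin nP) → AppearsIn Λ′ (inj₁ p))
  × ((p : Fin nP) → AppearsIn Λ (inj₁ p) → WeaklyOmnipresent Λ′ d p)
  × (Σ (Fin (Program.k Λ) → Fin (Program.k Λ′)) λ e →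
       Injective _≡_ _≡_ e × ((Y : Fin (Program.k Λ)) → Omnipresent Λ′ d (inj₂ (e Y))))
  × (sizeP Λ′ ≤ C * (d * sizeP Λ + nP))

padded-isOmnipresentVersion : ∀ {m} (ids : Fin m → Fin nP) (Λ : Program nP) → WF Λ → ∀ d →
  1 ≤ suc d * sizeP Λ + nP → IsOmnipresentVersion ids (suc d) 15 Λ (padded Λ (suc d))
padded-isOmnipresentVersion ids Λ wf d nonempty =
  WF-padded Λ (suc d) wf ,
  withHiddenHead-stronglyEquivalent Λ _ _ ids ,
  appearsIn-padded Λ (suc d) ,
  props-weaklyOmnipresent Λ (suc d) ,
  (suc , suc-injective ,
   λ Y → skeleton-omnipresent Λ (suc d) (inj₂ (suc Y)) Y (head-occursFree-skeleton Λ Y)) ,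
  sizeP-padded Λ d nonempty

lemma3 : Σ ℕ λ C →
    (nP m : ℕ) (ids : Fin m → Fin nP) → Injective _≡_ _≡_ ids →
    (Λ : Program nP) → WF Λ → (d : ℕ) → 1 ≤ d →
    Σ (Program nP) λ Λ' →
      WF Λ'
      × StronglyEquivalent ids Λ Λ'
      × ((p : Fin nP) → AppearsIn Λ' (inj₁ p))
      × ((p : Fin nP) → AppearsIn Λ (inj₁ p) → WeaklyOmnipresent Λ' d p)
      × (Σ (Fin (Program.k Λ) → Fin (Program.k Λ')) λ e →
           Injective _≡_ _≡_ e × ((Y : Fin (Program.k Λ)) → Omnipresent Λ' d (inj₂ (e Y))))
      × (sizeP Λ' ≤ C * (d * sizeP Λ + nP))
lemma3 = 15 , λ where
  -- Without symbols and heads the size bound is 0, so Λ itself must be returned.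
  zero _ _ _ Λ@record { k = zero } wf _ _ →
    Λ , wf , (λ _ _ _ _ → refl) , (λ ()) , (λ ()) , (id , id , λ ()) , z≤n
  zero _ ids _ Λ@record { k = suc _ } wf (suc d) (s≤s z≤n) →
    padded Λ (suc d) , padded-isOmnipresentVersion ids Λ wf d (s≤s z≤n)
  (suc n) _ ids _ Λ wf (suc d) (s≤s z≤n) →
    padded Λ (suc d) , padded-isOmnipresentVersion ids Λ wf d (≤-trans (s≤s z≤n) (m≤n+m (suc n) _))
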